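{- Let $n\geq 3$ and let $1,2,\ldots,s_{\delta(n)},s_{\delta(n)+1}=n$ be an addition chain producing $n$ of length $\delta(n)$, with associated generators $s_i=a_i+r_i$ for $2\leq i\leq \delta(n)+1$, where $a_2=r_2=1$ and $a_{i+1}=a_i+r_i$ for $2\leq i\leq \delta(n)$. Then \[\frac{n-1}{\sup(r_j)_{j=2}^{\delta(n)+1}}\leq \delta(n)\leq \frac{n-1}{\inf(r_j)_{j=2}^{\delta(n)+1}}.\]
   Context: An addition chain of length $k-1$ producing $n$ is a sequence $1=s_1,2=s_2,\ldots,s_{k-1},s_k=n$ in which each term $s_j$ ($j\geq 3$) is the sum of two earlier terms. In this paper each term is written via a partition $s_i=a_i+r_i$ ($2\leq i\leq k$), called the $i$-th generator, with $2=1+1$ (i.e. $a_2=r_2=1$) and $a_{i+1}=a_i+r_i$; $a_i$ is the determiner and $r_i$ the regulator of the $i$-th generator. Here $k-1=\delta(n)$. -}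

module Defs where

open import Data.Nat using (ℕ; zero; suc; _+_; _≤_; _<_; _⊔_; _⊓_)
open import Data.Product using (Σ; _×_)
open import Relation.Binary.PropositionalEquality using (_≡_)

-- An addition chain  1 = s 1, 2 = s 2, ..., s (k-1), s k = n  of length
-- k - 1 = δ, indexed from 1 (values of s outside 1..δ+1 are irrelevant),
-- together with its generators  s i = a i + r i  (2 ≤ i ≤ δ+1) where
-- a 2 = r 2 = 1 and a (i+1) = a i + r i  (2 ≤ i ≤ δ).
record ChainWithGenerators (n δ : ℕ) (s a r : ℕ → ℕ) : Set where
  field
    s-one   : s 1 ≡ 1
    s-two   : s 2 ≡ 2
    s-last  : s (suc δ) ≡ n
    s-sum   : ∀ j → 3 ≤ j → j ≤ suc δ →
              Σ ℕ λ p → Σ ℕ λ q →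
                (1 ≤ p × p < j) × (1 ≤ q × q < j) × (s j ≡ s p + s q)
    gen     : ∀ i → 2 ≤ i → i ≤ suc δ → s i ≡ a i + r i
    a-two   : a 2 ≡ 1
    r-two   : r 2 ≡ 1
    a-step  : ∀ i → 2 ≤ i → i ≤ δ → a (suc i) ≡ a i + r i

supFrom : (ℕ → ℕ) → ℕ → ℕ → ℕ
supFrom f i zero    = f i
supFrom f i (suc m) = f i ⊔ supFrom f (suc i) m

infFrom : (ℕ → ℕ) → ℕ → ℕ → ℕ
infFrom f i zero    = f i
infFrom f i (suc m) = f i ⊓ infFrom f (suc i) m

module Submission where

-- In an addition chain with generators s i = a i + r i the determiners
-- telescope: a (i+1) = a i + r i, so the last term is
--     n = s (δ+1) = a 2 + r 2 + r 3 + ... + r (δ+1) = 1 + Σ_{j=2}^{δ+1} r j .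
-- Hence n - 1 is a sum of δ regulators, and it lies between δ times their
-- minimum and δ times their maximum, which is exactly the corollary.

open import Defs
open import Data.Nat using (ℕ; zero; suc; _+_; _∸_; _*_; _≤_; _<_; s≤s)
open import Data.Nat.Properties
open import Data.Product using (_×_; _,_)
open import Relation.Binary.PropositionalEquality
open import Relation.Nullary using (contradiction)

sumFrom : (ℕ → ℕ) → ℕ → ℕ → ℕ
sumFrom f i zero    = f i
sumFrom f i (suc m) = f i + sumFrom f (suc i) m

sumFrom≤*supFrom : ∀ f i m → sumFrom f i m ≤ suc m * supFrom f i m
sumFrom≤*supFrom f i zero    = ≤-reflexive (sym (+-identityʳ (f i)))
sumFrom≤*supFrom f i (suc m) =
  +-mono-≤ (m≤m⊔n (f i) sup)
           (≤-trans (sumFrom≤*supFrom f (suc i) m) (*-monoʳ-≤ (suc m) (m≤n⊔m (f i) sup)))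
  where sup = supFrom f (suc i) m

*infFrom≤sumFrom : ∀ f i m → suc m * infFrom f i m ≤ sumFrom f i m
*infFrom≤sumFrom f i zero    = ≤-reflexive (+-identityʳ (f i))
*infFrom≤sumFrom f i (suc m) =
  +-mono-≤ (m⊓n≤m (f i) inf)
           (≤-trans (*-monoʳ-≤ (suc m) (m⊓n≤n (f i) inf)) (*infFrom≤sumFrom f (suc i) m))
  where inf = infFrom f (suc i) m

sumFrom-snoc : ∀ f i m → sumFrom f i (suc m) ≡ sumFrom f i m + f (suc m + i)
sumFrom-snoc f i zero    = refl
sumFrom-snoc f i (suc m) = begin
  f i + sumFrom f (suc i) (suc m)                 ≡⟨ cong (f i +_) (sumFrom-snoc f (suc i) m) ⟩
  f i + (sumFrom f (suc i) m + f (suc m + suc i)) ≡⟨ sym (+-assoc (f i) _ _) ⟩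
  f i + sumFrom f (suc i) m + f (suc m + suc i)   ≡⟨ cong (λ j → sumFrom f i (suc m) + f j) (+-suc (suc m) i) ⟩
  sumFrom f i (suc m) + f (suc (suc m) + i)       ∎
  where open ≡-Reasoning

telescope : ∀ (a r : ℕ → ℕ) i m →
  (∀ j → j < m → a (suc (j + i)) ≡ a (j + i) + r (j + i)) →
  a i + sumFrom r i m ≡ a (m + i) + r (m + i)
telescope a r i zero    step = refl
telescope a r i (suc m) step = begin
  a i + sumFrom r i (suc m)                  ≡⟨ cong (a i +_) (sumFrom-snoc r i m) ⟩
  a i + (sumFrom r i m + r (suc m + i))      ≡⟨ sym (+-assoc (a i) _ _) ⟩
  a i + sumFrom r i m + r (suc m + i)        ≡⟨ cong (_+ r (suc m + i)) (telescope a r i m step′) ⟩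
  a (m + i) + r (m + i) + r (suc m + i)      ≡⟨ cong (_+ r (suc m + i)) (sym (step m ≤-refl)) ⟩
  a (suc m + i) + r (suc m + i)              ∎
  where
  open ≡-Reasoning
  step′ : ∀ j → j < m → a (suc (j + i)) ≡ a (j + i) + r (j + i)
  step′ j j<m = step j (m<n⇒m<1+n j<m)

-- The chain identity: a chain of length δ = m+1 produces n = 1 + r 2 + ... + r (m+2),
-- because its determiners telescope from a 2 = 1 up to s (δ+1) = a (δ+1) + r (δ+1).
n≡1+sumOfRegulators : ∀ {n m s a r} → ChainWithGenerators n (suc m) s a r →
  n ≡ suc (sumFrom r 2 m)
n≡1+sumOfRegulators {n} {m} {s} {a} {r} C = begin
  n                          ≡⟨ sym s-last ⟩
  s (2 + m)                  ≡⟨ cong s (+-comm 2 m) ⟩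
  s (m + 2)                  ≡⟨ gen (m + 2) 2≤m+2 (≤-reflexive (+-comm m 2)) ⟩
  a (m + 2) + r (m + 2)      ≡⟨ sym (telescope a r 2 m determinerStep) ⟩
  a 2 + sumFrom r 2 m        ≡⟨ cong (_+ sumFrom r 2 m) a-two ⟩
  suc (sumFrom r 2 m)        ∎
  where
  open ChainWithGenerators C
  open ≡-Reasoning
  2≤m+2 : 2 ≤ m + 2
  2≤m+2 = m≤n+m 2 m
  determinerStep : ∀ j → j < m → a (suc (j + 2)) ≡ a (j + 2) + r (j + 2)
  determinerStep j j<m =
    a-step (j + 2) (m≤n+m 2 j) (≤-trans (≤-reflexive (+-comm j 2)) (s≤s j<m))

corollary2p3 : (n δ : ℕ) (s a r : ℕ → ℕ) → 3 ≤ n → ChainWithGenerators n δ s a r →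
    ((n ∸ 1) ≤ δ * supFrom r 2 (δ ∸ 1)) × (δ * infFrom r 2 (δ ∸ 1) ≤ (n ∸ 1))
-- A chain of length 0 produces only n = s 1 = 1.
corollary2p3 n zero s a r 3≤n C =
  contradiction (subst (3 ≤_) (trans (sym s-last) s-one) 3≤n) λ { (s≤s ()) }
  where open ChainWithGenerators C
-- Otherwise n - 1 is the sum of the δ regulators r 2, ..., r (δ+1).
corollary2p3 n (suc m) s a r 3≤n C =
  subst (_≤ suc m * supFrom r 2 m) (sym n∸1≡sum) (sumFrom≤*supFrom r 2 m) ,
  subst (suc m * infFrom r 2 m ≤_) (sym n∸1≡sum) (*infFrom≤sumFrom r 2 m)
  where
  n∸1≡sum : n ∸ 1 ≡ sumFrom r 2 m
  n∸1≡sum = cong (_∸ 1) (n≡1+sumOfRegulators C)
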